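{- Let $k, l$ be positive integers with $k \geq 3l$. Then every graph $G$ with $\chi(G) > k$ contains a weakly $l$-connected subgraph $H$ such that $\chi(H) > k - 2l$.
   Context: All graphs are finite and simple. A separation of a graph $G$ is a pair $(A,B)$ with $A\cup B = V(G)$ such that every edge of $G$ has both ends in $A$ or both ends in $B$; it is proper if $A - B \neq \emptyset$ and $B - A \neq \emptyset$; its order is $|A\cap B|$. A graph $G$ is weakly $k$-connected if for every proper separation $(A,B)$ of $G$ of order at most $k$ we have $\min\{|A-B|,|B-A|\} < |A\cap B|$. -}

module Defs where

open import Data.Nat using (ℕ; _≤_; _<_; _⊓_)
open import Data.Fin using (Fin)
open import Data.Fin.Subset using (Subset; _∈_; _∉_; _∩_; _─_; ∣_∣)
open import Data.Product using (Σ; ∃; _×_)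
open import Data.Sum using (_⊎_)
open import Relation.Nullary using (¬_; Dec)
open import Relation.Binary.PropositionalEquality using (_≡_; _≢_)
open import Function.Definitions using (Injective)

record Graph : Set₁ where
  field
    n     : ℕ
    _~_   : Fin n → Fin n → Set
    ~-sym : ∀ {x y} → x ~ y → y ~ x
    ~-irr : ∀ {x} → ¬ (x ~ x)
    ~-dec : ∀ x y → Dec (x ~ y)
open Graph public

ProperColouring : (G : Graph) → ℕ → Set
ProperColouring G k =
  Σ (Fin (n G) → Fin k) λ c → ∀ x y → _~_ G x y → c x ≢ c y

χ>_ : ℕ → Graph → Set
(χ> k) G = ¬ ProperColouring G k

_⊆G_ : Graph → Graph → Set
H ⊆G G = Σ (Fin (n H) → Fin (n G)) λ f →
  Injective _≡_ _≡_ f × (∀ x y → _~_ H x y → _~_ G (f x) (f y))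

IsSeparation : (G : Graph) → Subset (n G) → Subset (n G) → Set
IsSeparation G A B =
  (∀ v → v ∈ A ⊎ v ∈ B) ×
  (∀ x y → _~_ G x y → (x ∈ A × y ∈ A) ⊎ (x ∈ B × y ∈ B))

IsProper : {m : ℕ} → Subset m → Subset m → Set
IsProper A B = (∃ λ v → v ∈ A × v ∉ B) × (∃ λ v → v ∈ B × v ∉ A)

order : {m : ℕ} → Subset m → Subset m → ℕ
order A B = ∣ A ∩ B ∣

WeaklyConnected : ℕ → Graph → Set
WeaklyConnected k G =
  ∀ (A B : Subset (n G)) → IsSeparation G A B → IsProper A B →
  order A B ≤ k → (∣ A ─ B ∣ ⊓ ∣ B ─ A ∣) < order A B

-- We prove a stronger, precolouring statement by induction on the number of
-- vertices: for every subgraph H of G, every set Z of at most 2l vertices of H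
-- and every colouring of Z with k colours that is proper on Z, either G has the
-- desired weakly l-connected subgraph or the colouring of Z extends to a proper
-- k-colouring of H.  If H is weakly l-connected, then either χ(H) > k - 2l or a
-- (k - 2l)-colouring of H, recoloured with colours unused on Z, does it.
-- Otherwise H has a separation (A, B) of order s ≤ l with both sides of size at
-- least s.  If some vertex of B - A lies outside Z and Z has few vertices in
-- B - A, colour H[A ∪ (Z ∩ B)] first, then H[B] precoloured on
-- (A ∩ B) ∪ (Z ∩ B); the two colourings agree on the overlap and glue.  Choosing
-- the side with fewer vertices of Z, this fails only if every vertex outside Z
-- lies in A ∩ B; then H has at most 2l + l ≤ k vertices and can be coloured
-- injectively outside Z.

module Submission where

open import Defs
open import Data.Nat using (ℕ; zero; suc; z≤n; s≤s; _⊓_; _≤_; _<_; _+_; _*_; _∸_; _≤?_; _<?_)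
open import Data.Nat.Properties hiding (suc-injective)
open import Data.Nat.Induction using (<-wellFounded)
open import Data.Product using (Σ; ∃; ∃₂; _×_; _,_; proj₁; proj₂)
open import Data.Sum using (_⊎_; inj₁; inj₂)
import Data.Sum as Sum
open import Data.Empty using (⊥-elim)
open import Data.Fin using (Fin; zero; suc; inject≤; fromℕ<) renaming (_≟_ to _≟ᶠ_)
open import Data.Fin.Properties using (any?; all?; inject≤-injective; suc-injective)
open import Data.Fin.Subset
open import Data.Fin.Subset.Properties
open import Data.Vec using (_∷_; []; here; there)
open import Data.Vec.Functional using () renaming (_∷_ to _∷ᶠ_)
open import Function using (_∘_; id)
open import Function.Definitions using (Injective)
open import Induction.WellFounded using (module All)
open import Level using (0ℓ) renaming (suc to lsuc)
open import Relation.Binary.Construct.On as On using ()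
open import Relation.Binary.PropositionalEquality
  using (_≡_; _≢_; refl; sym; trans; cong; subst; subst₂; module ≡-Reasoning)
open import Relation.Nullary using (Dec; yes; no; contradiction)
open import Relation.Nullary.Decidable using (_×-dec_; _⊎-dec_; _→-dec_; ¬?; decidable-stable; toSum)

private
  variable
    N : ℕ
    x : Fin N
    p q r : Subset N

x∈p─q⁻ : ∀ {N} {x : Fin N} (p q : Subset N) → x ∈ p ─ q → x ∈ p × x ∉ q
x∈p─q⁻ (inside ∷ p)  (outside ∷ q) here      = here , λ ()
x∈p─q⁻ {x = zero} (outside ∷ p) (inside ∷ q)  ()
x∈p─q⁻ {x = zero} (outside ∷ p) (outside ∷ q) ()
x∈p─q⁻ (_ ∷ p)       (_ ∷ q)       (there h) =
  Data.Product.map there (λ x∉q → λ { (there x∈q) → x∉q x∈q }) (x∈p─q⁻ p q h)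

∣p∪q∣+∣p∩q∣≡∣p∣+∣q∣ : ∀ (p q : Subset N) → ∣ p ∪ q ∣ + ∣ p ∩ q ∣ ≡ ∣ p ∣ + ∣ q ∣
∣p∪q∣+∣p∩q∣≡∣p∣+∣q∣ []            []            = refl
∣p∪q∣+∣p∩q∣≡∣p∣+∣q∣ (inside ∷ p)  (inside ∷ q)  =
  cong suc (trans (+-suc _ _) (trans (cong suc (∣p∪q∣+∣p∩q∣≡∣p∣+∣q∣ p q)) (sym (+-suc _ _))))
∣p∪q∣+∣p∩q∣≡∣p∣+∣q∣ (inside ∷ p)  (outside ∷ q) = cong suc (∣p∪q∣+∣p∩q∣≡∣p∣+∣q∣ p q)
∣p∪q∣+∣p∩q∣≡∣p∣+∣q∣ (outside ∷ p) (inside ∷ q)  =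
  trans (cong suc (∣p∪q∣+∣p∩q∣≡∣p∣+∣q∣ p q)) (sym (+-suc _ _))
∣p∪q∣+∣p∩q∣≡∣p∣+∣q∣ (outside ∷ p) (outside ∷ q) = ∣p∪q∣+∣p∩q∣≡∣p∣+∣q∣ p q

∣p∪q∣≤∣p∣+∣q∣ : ∀ (p q : Subset N) → ∣ p ∪ q ∣ ≤ ∣ p ∣ + ∣ q ∣
∣p∪q∣≤∣p∣+∣q∣ p q = ≤-trans (m≤m+n _ _) (≤-reflexive (∣p∪q∣+∣p∩q∣≡∣p∣+∣q∣ p q))

p⊆q∪r⇒∣p∣≤∣q∣+∣r∣ : p ⊆ q ∪ r → ∣ p ∣ ≤ ∣ q ∣ + ∣ r ∣
p⊆q∪r⇒∣p∣≤∣q∣+∣r∣ {q = q} {r} p⊆q∪r = ≤-trans (p⊆q⇒∣p∣≤∣q∣ p⊆q∪r) (∣p∪q∣≤∣p∣+∣q∣ q r)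

disjoint⇒∣p∣+∣q∣≤∣r∣ : ∀ {N} {p q r : Subset N} →
                       p ⊆ r → q ⊆ r → Empty (p ∩ q) → ∣ p ∣ + ∣ q ∣ ≤ ∣ r ∣
disjoint⇒∣p∣+∣q∣≤∣r∣ {N} {p} {q} {r} p⊆r q⊆r p∩q-empty = begin
  ∣ p ∣ + ∣ q ∣              ≡⟨ sym (∣p∪q∣+∣p∩q∣≡∣p∣+∣q∣ p q) ⟩
  ∣ p ∪ q ∣ + ∣ p ∩ q ∣      ≡⟨ cong (λ s → ∣ p ∪ q ∣ + ∣ s ∣) (Empty-unique p∩q-empty) ⟩
  ∣ p ∪ q ∣ + ∣ ⊥ {n = N} ∣  ≡⟨ cong (∣ p ∪ q ∣ +_) (∣⊥∣≡0 N) ⟩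
  ∣ p ∪ q ∣ + 0              ≡⟨ +-identityʳ _ ⟩
  ∣ p ∪ q ∣                  ≤⟨ p⊆q⇒∣p∣≤∣q∣ (λ h → Sum.[ p⊆r , q⊆r ] (x∈p∪q⁻ p q h)) ⟩
  ∣ r ∣                      ∎
  where open ≤-Reasoning

∣p∣+∣∁p∣≡n : ∀ (p : Subset N) → ∣ p ∣ + ∣ ∁ p ∣ ≡ N
∣p∣+∣∁p∣≡n p = trans (cong (∣ p ∣ +_) (∣∁p∣≡n∸∣p∣ p)) (m+[n∸m]≡n (∣p∣≤n p))

p⊆q⇒∣p∣≤∣q∩p∣ : p ⊆ q → ∣ p ∣ ≤ ∣ q ∩ p ∣
p⊆q⇒∣p∣≤∣q∩p∣ p⊆q = p⊆q⇒∣p∣≤∣q∣ λ x∈p → x∈p∩q⁺ (p⊆q x∈p , x∈p)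

∣p∩[q─r]∣+∣p∩[r─q]∣≤∣p∣ : ∀ (p q r : Subset N) → ∣ p ∩ (q ─ r) ∣ + ∣ p ∩ (r ─ q) ∣ ≤ ∣ p ∣
∣p∩[q─r]∣+∣p∩[r─q]∣≤∣p∣ p q r = disjoint⇒∣p∣+∣q∣≤∣r∣ (p∩q⊆p p _) (p∩q⊆p p _) λ (x , h) →
  let x∈q─r = proj₂ (x∈p∩q⁻ p _ (proj₁ (x∈p∩q⁻ _ _ h)))
      x∈r─q = proj₂ (x∈p∩q⁻ p _ (proj₂ (x∈p∩q⁻ _ _ h)))
  in proj₂ (x∈p─q⁻ q r x∈q─r) (proj₁ (x∈p─q⁻ r q x∈r─q))

x∉p⇒∣p∣<n : ∀ {N} {x : Fin N} {p : Subset N} → x ∉ p → ∣ p ∣ < N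
x∉p⇒∣p∣<n {N} {x} {p} x∉p = subst (∣ p ∣ <_) (∣⊤∣≡n N) (p⊂q⇒∣p∣<∣q∣ (⊆⊤ , x , ∈⊤ , x∉p))

⊆⊎∃∉ : ∀ (p q : Subset N) → p ⊆ q ⊎ ∃ λ x → x ∈ p × x ∉ q
⊆⊎∃∉ p q with any? (λ x → (x ∈? p) ×-dec ¬? (x ∈? q))
... | yes x∈p─q = inj₂ x∈p─q
... | no  none  = inj₁ λ {x} x∈p → decidable-stable (x ∈? q) (λ x∉q → none (x , x∈p , x∉q))

ι : (X : Subset N) → Fin ∣ X ∣ → Fin N
ι (inside ∷ X)  zero    = zero
ι (inside ∷ X)  (suc i) = suc (ι X i)
ι (outside ∷ X) i       = suc (ι X i)

ι-injective : (X : Subset N) → Injective _≡_ _≡_ (ι X)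
ι-injective (inside ∷ X)  {zero}  {zero}  _  = refl
ι-injective (inside ∷ X)  {suc i} {suc j} eq = cong suc (ι-injective X (suc-injective eq))
ι-injective (outside ∷ X)                 eq = ι-injective X (suc-injective eq)

ι⁻¹ : (X : Subset N) → x ∈ X → Fin ∣ X ∣
ι⁻¹ (inside ∷ X)  here      = zero
ι⁻¹ (inside ∷ X)  (there h) = suc (ι⁻¹ X h)
ι⁻¹ (outside ∷ X) (there h) = ι⁻¹ X h

ι∘ι⁻¹ : (X : Subset N) (x∈X : x ∈ X) → ι X (ι⁻¹ X x∈X) ≡ x
ι∘ι⁻¹ (inside ∷ X)  here      = refl
ι∘ι⁻¹ (inside ∷ X)  (there h) = cong suc (ι∘ι⁻¹ X h)
ι∘ι⁻¹ (outside ∷ X) (there h) = cong suc (ι∘ι⁻¹ X h)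

ι⁻¹∘ι : (X : Subset N) {i : Fin ∣ X ∣} (ιi∈X : ι X i ∈ X) → ι⁻¹ X ιi∈X ≡ i
ι⁻¹∘ι X ιi∈X = ι-injective X (ι∘ι⁻¹ X ιi∈X)

ι∈ : (X : Subset N) (i : Fin ∣ X ∣) → ι X i ∈ X
ι∈ (inside ∷ X)  zero    = here
ι∈ (inside ∷ X)  (suc i) = there (ι∈ X i)
ι∈ (outside ∷ X) i       = there (ι∈ X i)

restrict : (X : Subset N) → Subset N → Subset ∣ X ∣
restrict []            []      = []
restrict (inside ∷ X)  (s ∷ Z) = s ∷ restrict X Z
restrict (outside ∷ X) (_ ∷ Z) = restrict X Z

∈restrict⁺ : (X Z : Subset N) (i : Fin ∣ X ∣) → ι X i ∈ Z → i ∈ restrict X Z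
∈restrict⁺ (inside ∷ X)  (_ ∷ Z) zero    here      = here
∈restrict⁺ (inside ∷ X)  (_ ∷ Z) (suc i) (there h) = there (∈restrict⁺ X Z i h)
∈restrict⁺ (outside ∷ X) (_ ∷ Z) i       (there h) = ∈restrict⁺ X Z i h

∈restrict⁻ : (X Z : Subset N) (i : Fin ∣ X ∣) → i ∈ restrict X Z → ι X i ∈ Z
∈restrict⁻ (inside ∷ X)  (_ ∷ Z) zero    here      = here
∈restrict⁻ (inside ∷ X)  (_ ∷ Z) (suc i) (there h) = there (∈restrict⁻ X Z i h)
∈restrict⁻ (outside ∷ X) (_ ∷ Z) i       h         = there (∈restrict⁻ X Z i h)

∣restrict∣≤ : (X Z : Subset N) → ∣ restrict X Z ∣ ≤ ∣ Z ∣
∣restrict∣≤ []            []            = z≤n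
∣restrict∣≤ (inside ∷ X)  (inside ∷ Z)  = s≤s (∣restrict∣≤ X Z)
∣restrict∣≤ (inside ∷ X)  (outside ∷ Z) = ∣restrict∣≤ X Z
∣restrict∣≤ (outside ∷ X) (s ∷ Z)       = ≤-trans (∣restrict∣≤ X Z) (∣p∣≤∣x∷p∣ s Z)

patch : ∀ {A : Set} (X : Subset N) → (Fin ∣ X ∣ → A) → (Fin N → A) → Fin N → A
patch X f g x with x ∈? X
... | yes x∈X = f (ι⁻¹ X x∈X)
... | no  _   = g x

patch-ι : ∀ {A : Set} (X : Subset N) (f : Fin ∣ X ∣ → A) (g : Fin N → A) (i : Fin ∣ X ∣) →
          patch X f g (ι X i) ≡ f i
patch-ι X f g i with ι X i ∈? X
... | yes ιi∈X = cong f (ι⁻¹∘ι X ιi∈X)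
... | no  ιi∉X = contradiction (ι∈ X i) ιi∉X

patch-∈ : ∀ {A : Set} (X : Subset N) (f : Fin ∣ X ∣ → A) (g : Fin N → A) (x∈X : x ∈ X) →
          patch X f g x ≡ f (ι⁻¹ X x∈X)
patch-∈ X f g x∈X =
  subst (λ y → patch X f g y ≡ f (ι⁻¹ X x∈X)) (ι∘ι⁻¹ X x∈X) (patch-ι X f g (ι⁻¹ X x∈X))

patch-∉ : ∀ {A : Set} (X : Subset N) (f : Fin ∣ X ∣ → A) (g : Fin N → A) → x ∉ X →
          patch X f g x ≡ g x
patch-∉ {x = x} X f g x∉X with x ∈? X
... | yes x∈X = contradiction x∈X x∉X
... | no  _   = refl

image : ∀ {m k} → (Fin m → Fin k) → Subset k
image {zero}  f = ⊥
image {suc m} f = ⁅ f zero ⁆ ∪ image (f ∘ suc)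

∈image : ∀ {m k} (f : Fin m → Fin k) (i : Fin m) → f i ∈ image f
∈image f zero    = x∈p∪q⁺ (inj₁ (x∈⁅x⁆ (f zero)))
∈image f (suc i) = x∈p∪q⁺ (inj₂ (∈image (f ∘ suc) i))

∣image∣≤ : ∀ {m k} (f : Fin m → Fin k) → ∣ image f ∣ ≤ m
∣image∣≤ {zero}  {k} f = ≤-reflexive (∣⊥∣≡0 k)
∣image∣≤ {suc m} f     = begin
  ∣ ⁅ f zero ⁆ ∪ image (f ∘ suc) ∣     ≤⟨ ∣p∪q∣≤∣p∣+∣q∣ ⁅ f zero ⁆ (image (f ∘ suc)) ⟩
  ∣ ⁅ f zero ⁆ ∣ + ∣ image (f ∘ suc) ∣ ≡⟨ cong (_+ ∣ image (f ∘ suc) ∣) (∣⁅x⁆∣≡1 (f zero)) ⟩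
  suc ∣ image (f ∘ suc) ∣              ≤⟨ s≤s (∣image∣≤ (f ∘ suc)) ⟩
  suc m                                ∎
  where open ≤-Reasoning

freshInjection : ∀ {m k p} (g : Fin p → Fin k) → p + m ≤ k →
                 Σ (Fin m → Fin k) λ φ → Injective _≡_ _≡_ φ × (∀ i j → φ i ≢ g j)
freshInjection {m} {k} {p} g p+m≤k = φ , φ-injective , φ-fresh
  where
  F : Subset k
  F = ∁ (image g)

  m≤∣F∣ : m ≤ ∣ F ∣
  m≤∣F∣ = begin
    m                  ≡⟨ sym (m+n∸m≡n p m) ⟩
    p + m ∸ p          ≤⟨ ∸-monoˡ-≤ p p+m≤k ⟩
    k ∸ p              ≤⟨ ∸-monoʳ-≤ k (∣image∣≤ g) ⟩
    k ∸ ∣ image g ∣    ≡⟨ sym (∣∁p∣≡n∸∣p∣ (image g)) ⟩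
    ∣ F ∣              ∎
    where open ≤-Reasoning

  φ : Fin m → Fin k
  φ i = ι F (inject≤ i m≤∣F∣)

  φ-injective : Injective _≡_ _≡_ φ
  φ-injective eq = inject≤-injective m≤∣F∣ m≤∣F∣ _ _ (ι-injective F eq)

  φ-fresh : ∀ i j → φ i ≢ g j
  φ-fresh i j eq = x∈∁p⇒x∉p (ι∈ F (inject≤ i m≤∣F∣)) (subst (_∈ image g) (sym eq) (∈image g j))

-- Without function extensionality P has to respect pointwise equality: the
-- search finds (f zero ∷ f ∘ suc) rather than f itself.
anyFunction? : ∀ {m k} {P : (Fin m → Fin k) → Set} → (∀ f → Dec (P f)) →
               (∀ {f g} → (∀ x → f x ≡ g x) → P f → P g) → Dec (∃ P)
anyFunction? {zero} P? resp with P? (λ ())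
... | yes p = yes (_ , p)
... | no ¬p = no λ (f , pf) → ¬p (resp (λ ()) pf)
anyFunction? {suc m} {k} {P} P? resp
  with anyFunction? {P = λ g → ∃ λ a → P (a ∷ᶠ g)} (λ g → any? (λ a → P? (a ∷ᶠ g)))
         (λ g≗g′ (a , p) → a , resp (λ { zero → refl ; (suc i) → g≗g′ i }) p)
... | yes (g , a , p) = yes (a ∷ᶠ g , p)
... | no ¬q = no λ (f , pf) → ¬q (f ∘ suc , f zero , resp (λ { zero → refl ; (suc i) → refl }) pf)

induced : (H : Graph) → Subset (n H) → Graph
induced H X = record
  { n     = ∣ X ∣
  ; _~_   = λ i j → _~_ H (ι X i) (ι X j)
  ; ~-sym = ~-sym H
  ; ~-irr = ~-irr H
  ; ~-dec = λ i j → ~-dec H (ι X i) (ι X j)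
  }

induced-⊆G : (H : Graph) (X : Subset (n H)) → induced H X ⊆G H
induced-⊆G H X = ι X , ι-injective X , λ _ _ e → e

⊆G-trans : ∀ {H₁ H₂ H₃} → H₁ ⊆G H₂ → H₂ ⊆G H₃ → H₁ ⊆G H₃
⊆G-trans (f , f-inj , f-edge) (g , g-inj , g-edge) =
  g ∘ f , f-inj ∘ g-inj , λ x y e → g-edge (f x) (f y) (f-edge x y e)

colourable? : (H : Graph) (k : ℕ) → Dec (ProperColouring H k)
colourable? H k = anyFunction?
  (λ c → all? λ x → all? λ y → ~-dec H x y →-dec ¬? (c x ≟ᶠ c y))
  (λ c≗c′ c-ok x y e eq → c-ok x y e (trans (c≗c′ x) (trans eq (sym (c≗c′ y)))))

idColouring : (H : Graph) → ProperColouring H (n H)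
idColouring H = id , λ x y e x≡y → ~-irr H (subst (_~_ H x) (sym x≡y) e)

ProperColouring-induced : ∀ {k} (H : Graph) (X : Subset (n H)) →
                          ProperColouring H k → ProperColouring (induced H X) k
ProperColouring-induced H X (c , c-ok) = c ∘ ι X , λ i j → c-ok (ι X i) (ι X j)

ProperOn : ∀ {k} (H : Graph) → Subset (n H) → (Fin (n H) → Fin k) → Set
ProperOn H X c = ∀ {x y} → x ∈ X → y ∈ X → _~_ H x y → c x ≢ c y

_≈[_]_ : ∀ {A : Set} → (Fin N → A) → Subset N → (Fin N → A) → Set
f ≈[ Z ] g = ∀ {z} → z ∈ Z → f z ≡ g z

ExtensionOn : ∀ {k} (H : Graph) (X Z : Subset (n H)) → (Fin (n H) → Fin k) → Set
ExtensionOn {k} H X Z pre = Σ (Fin (n H) → Fin k) λ c → ProperOn H X c × c ≈[ Z ] pre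

Extension : ∀ {k} (H : Graph) (Z : Subset (n H)) → (Fin (n H) → Fin k) → Set
Extension H = ExtensionOn H ⊤

ProperOn-⊆ : ∀ {k} {H : Graph} {X Y : Subset (n H)} {c : Fin (n H) → Fin k} →
             X ⊆ Y → ProperOn H Y c → ProperOn H X c
ProperOn-⊆ X⊆Y c-ok x∈X y∈X = c-ok (X⊆Y x∈X) (X⊆Y y∈X)

ProperOn-restrict : ∀ {k} (H : Graph) (X Z : Subset (n H)) {pre : Fin (n H) → Fin k} →
                    ProperOn H Z pre → ProperOn (induced H X) (restrict X Z) (pre ∘ ι X)
ProperOn-restrict H X Z pre-ok {i} {j} i∈ j∈ = pre-ok (∈restrict⁻ X Z i i∈) (∈restrict⁻ X Z j j∈)

ProperOn⊤⇒ProperColouring : ∀ {k} (H : Graph) {c : Fin (n H) → Fin k} →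
                            ProperOn H ⊤ c → ProperColouring H k
ProperOn⊤⇒ProperColouring H {c} c-ok = c , λ x y → c-ok ∈⊤ ∈⊤

induced-edge : (H : Graph) (X : Subset (n H)) {x y : Fin (n H)} (x∈X : x ∈ X) (y∈X : y ∈ X) →
               _~_ H x y → _~_ (induced H X) (ι⁻¹ X x∈X) (ι⁻¹ X y∈X)
induced-edge H X x∈X y∈X = subst₂ (_~_ H) (sym (ι∘ι⁻¹ X x∈X)) (sym (ι∘ι⁻¹ X y∈X))

patch-ProperOn : ∀ {k} (H : Graph) (X : Subset (n H)) {c : Fin ∣ X ∣ → Fin k} (g : Fin (n H) → Fin k) →
                 ProperOn (induced H X) ⊤ c → ProperOn H X (patch X c g)
patch-ProperOn H X {c} g c-ok x∈X y∈X e eq =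
  c-ok ∈⊤ ∈⊤ (induced-edge H X x∈X y∈X e)
    (trans (sym (patch-∈ X c g x∈X)) (trans eq (patch-∈ X c g y∈X)))

extension-lift : ∀ {k} (H : Graph) (X Z : Subset (n H)) {pre : Fin (n H) → Fin k} →
                 Extension (induced H X) (restrict X Z) (pre ∘ ι X) → ExtensionOn H X Z pre
extension-lift H X Z {pre} (c , c-ok , c≈pre) = patch X c pre , patch-ProperOn H X pre c-ok , agree
  where
  agree : patch X c pre ≈[ Z ] pre
  agree {z} z∈Z with toSum (z ∈? X)
  ... | inj₂ z∉X = patch-∉ X c pre z∉X
  ... | inj₁ z∈X = begin
    patch X c pre z            ≡⟨ patch-∈ X c pre z∈X ⟩
    c (ι⁻¹ X z∈X)              ≡⟨ c≈pre (∈restrict⁺ X Z _ (subst (_∈ Z) (sym (ι∘ι⁻¹ X z∈X)) z∈Z)) ⟩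
    pre (ι X (ι⁻¹ X z∈X))      ≡⟨ cong pre (ι∘ι⁻¹ X z∈X) ⟩
    pre z                      ∎
    where open ≡-Reasoning

glueAlongSeparation : ∀ {k} (H : Graph) {X Y : Subset (n H)} {d₁ d₂ : Fin (n H) → Fin k} →
                      IsSeparation H X Y → ProperOn H X d₁ → ProperOn H Y d₂ → d₂ ≈[ X ∩ Y ] d₁ →
                      Extension H X d₁
glueAlongSeparation H {X} {Y} {d₁} {d₂} (covers , edges) d₁-ok d₂-ok d₂≈d₁ = c , c-ok , c≈d₁
  where
  c : Fin (n H) → Fin _
  c = patch X (d₁ ∘ ι X) d₂

  c≈d₁ : c ≈[ X ] d₁
  c≈d₁ x∈X = trans (patch-∈ X (d₁ ∘ ι X) d₂ x∈X) (cong d₁ (ι∘ι⁻¹ X x∈X))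

  c≈d₂ : c ≈[ Y ] d₂
  c≈d₂ {y} y∈Y with toSum (y ∈? X)
  ... | inj₁ y∈X = trans (c≈d₁ y∈X) (sym (d₂≈d₁ (x∈p∩q⁺ (y∈X , y∈Y))))
  ... | inj₂ y∉X = patch-∉ X (d₁ ∘ ι X) d₂ y∉X

  c-ok : ProperOn H ⊤ c
  c-ok {x} {y} _ _ e with edges x y e
  ... | inj₁ (x∈X , y∈X) = λ eq → d₁-ok x∈X y∈X e (trans (sym (c≈d₁ x∈X)) (trans eq (c≈d₁ y∈X)))
  ... | inj₂ (x∈Y , y∈Y) = λ eq → d₂-ok x∈Y y∈Y e (trans (sym (c≈d₂ x∈Y)) (trans eq (c≈d₂ y∈Y)))

extendByFreshColours : ∀ {k m} (H : Graph) (Z : Subset (n H)) {pre : Fin (n H) → Fin k} →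
                       ProperOn H Z pre → ProperColouring (induced H (∁ Z)) m → ∣ Z ∣ + m ≤ k →
                       Extension H Z pre
extendByFreshColours H Z {pre} pre-ok (col , col-ok) ∣Z∣+m≤k
  with freshInjection (pre ∘ ι Z) ∣Z∣+m≤k
... | φ , φ-injective , φ-fresh = c , c-ok , c≈pre
  where
  φ≢pre : ∀ i {z} → z ∈ Z → φ i ≢ pre z
  φ≢pre i z∈Z eq = φ-fresh i (ι⁻¹ Z z∈Z) (trans eq (cong pre (sym (ι∘ι⁻¹ Z z∈Z))))

  c : Fin (n H) → Fin _
  c = patch (∁ Z) (φ ∘ col) pre

  c≈pre : c ≈[ Z ] pre
  c≈pre z∈Z = patch-∉ (∁ Z) (φ ∘ col) pre (x∈p⇒x∉∁p z∈Z)

  c-outside : ∀ {x} (x∉Z : x ∉ Z) → c x ≡ φ (col (ι⁻¹ (∁ Z) (x∉p⇒x∈∁p x∉Z)))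
  c-outside x∉Z = patch-∈ (∁ Z) (φ ∘ col) pre (x∉p⇒x∈∁p x∉Z)

  c-ok : ProperOn H ⊤ c
  c-ok {x} {y} _ _ e with toSum (x ∈? Z) | toSum (y ∈? Z)
  ... | inj₁ x∈Z | inj₁ y∈Z = λ eq → pre-ok x∈Z y∈Z e (trans (sym (c≈pre x∈Z)) (trans eq (c≈pre y∈Z)))
  ... | inj₁ x∈Z | inj₂ y∉Z = λ eq → φ≢pre _ x∈Z (trans (sym (c-outside y∉Z)) (trans (sym eq) (c≈pre x∈Z)))
  ... | inj₂ x∉Z | inj₁ y∈Z = λ eq → φ≢pre _ y∈Z (trans (sym (c-outside x∉Z)) (trans eq (c≈pre y∈Z)))
  ... | inj₂ x∉Z | inj₂ y∉Z = λ eq →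
    col-ok _ _ (induced-edge H (∁ Z) _ _ e)
      (φ-injective (trans (sym (c-outside x∉Z)) (trans eq (c-outside y∉Z))))

isSeparation? : (H : Graph) (A B : Subset (n H)) → Dec (IsSeparation H A B)
isSeparation? H A B =
  all? (λ v → (v ∈? A) ⊎-dec (v ∈? B)) ×-dec
  all? (λ x → all? λ y → ~-dec H x y →-dec (((x ∈? A) ×-dec (y ∈? A)) ⊎-dec ((x ∈? B) ×-dec (y ∈? B))))

isProper? : (A B : Subset N) → Dec (IsProper A B)
isProper? A B = any? (λ v → (v ∈? A) ×-dec ¬? (v ∈? B)) ×-dec any? (λ v → (v ∈? B) ×-dec ¬? (v ∈? A))

IsSeparation-swap : (H : Graph) {A B : Subset (n H)} → IsSeparation H A B → IsSeparation H B A
IsSeparation-swap H (covers , edges) = Sum.swap ∘ covers , λ x y → Sum.swap ∘ edges x y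

record TightSeparation (l : ℕ) (H : Graph) (A B : Subset (n H)) : Set where
  field
    separation : IsSeparation H A B
    proper     : IsProper A B
    order≤l    : order A B ≤ l
    order≤∣A─B∣ : order A B ≤ ∣ A ─ B ∣
    order≤∣B─A∣ : order A B ≤ ∣ B ─ A ∣

order-comm : (A B : Subset N) → order A B ≡ order B A
order-comm A B = cong ∣_∣ (∩-comm A B)

TightSeparation-swap : ∀ {l} (H : Graph) {A B : Subset (n H)} →
                       TightSeparation l H A B → TightSeparation l H B A
TightSeparation-swap {l} H {A} {B} t = record
  { separation  = IsSeparation-swap H separation
  ; proper      = Data.Product.swap proper
  ; order≤l     = subst (_≤ l) (order-comm A B) order≤l
  ; order≤∣A─B∣ = subst (_≤ ∣ B ─ A ∣) (order-comm A B) order≤∣B─A∣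
  ; order≤∣B─A∣ = subst (_≤ ∣ A ─ B ∣) (order-comm A B) order≤∣A─B∣
  }
  where open TightSeparation t

weaklyConnected⊎tightSeparation : (l : ℕ) (H : Graph) → WeaklyConnected l H ⊎ ∃₂ (TightSeparation l H)
weaklyConnected⊎tightSeparation l H
  with anySubset? (λ A → anySubset? (λ B →
         isSeparation? H A B ×-dec isProper? A B ×-dec order A B ≤? l ×-dec
         ¬? (∣ A ─ B ∣ ⊓ ∣ B ─ A ∣ <? order A B)))
... | yes (A , B , sep , prop , s≤l , ¬<) = inj₂ (A , B , record
  { separation  = sep
  ; proper      = prop
  ; order≤l     = s≤l
  ; order≤∣A─B∣ = ≤-trans (≮⇒≥ ¬<) (m⊓n≤m _ _)
  ; order≤∣B─A∣ = ≤-trans (≮⇒≥ ¬<) (m⊓n≤n _ _)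
  })
... | no none = inj₁ λ A B sep prop s≤l →
  decidable-stable (_ <? _) λ ¬< → none (A , B , sep , prop , s≤l , ¬<)

∈Z∪[A∩B] : ∀ {A B Z : Subset N} → (∀ v → v ∈ A ⊎ v ∈ B) → A ─ B ⊆ Z → B ─ A ⊆ Z → ∀ v → v ∈ Z ∪ (A ∩ B)
∈Z∪[A∩B] {A = A} {B} covers A─B⊆Z B─A⊆Z v with toSum (v ∈? A) | toSum (v ∈? B)
... | inj₁ v∈A | inj₁ v∈B = x∈p∪q⁺ (inj₂ (x∈p∩q⁺ (v∈A , v∈B)))
... | inj₁ v∈A | inj₂ v∉B = x∈p∪q⁺ (inj₁ (A─B⊆Z (x∈p∧x∉q⇒x∈p─q v∈A v∉B)))
... | inj₂ v∉A | inj₁ v∈B = x∈p∪q⁺ (inj₁ (B─A⊆Z (x∈p∧x∉q⇒x∈p─q v∈B v∉A)))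
... | inj₂ v∉A | inj₂ v∉B = ⊥-elim (Sum.[ v∉A , v∉B ] (covers v))

extendInjectively : ∀ {k} (H : Graph) (Z : Subset (n H)) {pre : Fin (n H) → Fin k} →
                    ProperOn H Z pre → n H ≤ k → Extension H Z pre
extendInjectively H Z pre-ok n≤k = extendByFreshColours H Z pre-ok (idColouring (induced H (∁ Z)))
  (subst (_≤ _) (sym (∣p∣+∣∁p∣≡n Z)) n≤k)

m≤l⇒n≤o⇒n+o≤2l⇒m+n≤2l : ∀ {m n o l} → m ≤ l → n ≤ o → n + o ≤ 2 * l → m + n ≤ 2 * l
m≤l⇒n≤o⇒n+o≤2l⇒m+n≤2l {m} {n} {o} {l} m≤l n≤o n+o≤2l = begin
  m + n   ≤⟨ +-mono-≤ m≤l n≤l ⟩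
  l + l   ≡⟨ cong (l +_) (sym (+-identityʳ l)) ⟩
  2 * l   ∎
  where
  open ≤-Reasoning
  n≤l : n ≤ l
  n≤l = *-cancelˡ-≤ 2 (begin
    2 * n   ≡⟨ cong (n +_) (+-identityʳ n) ⟩
    n + n   ≤⟨ +-monoʳ-≤ n n≤o ⟩
    n + o   ≤⟨ n+o≤2l ⟩
    2 * l   ∎)

module _ (G : Graph) {k l : ℕ} (3l≤k : 3 * l ≤ k) where

  Witness : Set₁
  Witness = Σ Graph λ H → H ⊆G G × WeaklyConnected l H × (χ> (k ∸ 2 * l)) H

  private
    _>>=_ : ∀ {A B : Set} → Witness ⊎ A → (A → Witness ⊎ B) → Witness ⊎ B
    inj₁ w >>= _ = inj₁ w
    inj₂ a >>= f = f a

  Claim : Graph → Set₁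
  Claim H = H ⊆G G → (Z : Subset (n H)) → ∣ Z ∣ ≤ 2 * l → (pre : Fin (n H) → Fin k) →
            ProperOn H Z pre → Witness ⊎ Extension H Z pre

  Rec : Graph → Set₁
  Rec H = (H′ : Graph) → n H′ < n H → Claim H′

  2l≤k : 2 * l ≤ k
  2l≤k = ≤-trans (m≤n+m (2 * l) l) 3l≤k

  weaklyConnectedCase : ∀ {H} → WeaklyConnected l H → Claim H
  weaklyConnectedCase {H} wc H⊆G Z ∣Z∣≤2l pre pre-ok with colourable? H (k ∸ 2 * l)
  ... | no  χ>k∸2l = inj₁ (H , H⊆G , wc , χ>k∸2l)
  ... | yes col    = inj₂ (extendByFreshColours H Z pre-ok (ProperColouring-induced H (∁ Z) col)
                             (≤-trans (+-monoˡ-≤ (k ∸ 2 * l) ∣Z∣≤2l) (≤-reflexive (m+[n∸m]≡n 2l≤k))))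

  extendOnInduced : ∀ {H} → Rec H → H ⊆G G → (X : Subset (n H)) → ∣ X ∣ < n H →
                    (Z : Subset (n H)) → ∣ Z ∣ ≤ 2 * l → {pre : Fin (n H) → Fin k} →
                    ProperOn H Z pre → Witness ⊎ ExtensionOn H X Z pre
  extendOnInduced {H} rec H⊆G X ∣X∣<n Z ∣Z∣≤2l {pre} pre-ok =
    Sum.map₂ (extension-lift H X Z)
      (rec (induced H X) ∣X∣<n (⊆G-trans {induced H X} {H} {G} (induced-⊆G H X) H⊆G) (restrict X Z)
           (≤-trans (∣restrict∣≤ X Z) ∣Z∣≤2l) (pre ∘ ι X) (ProperOn-restrict H X Z pre-ok))

  glueAcross : ∀ {H} → Rec H → H ⊆G G → {A B : Subset (n H)} → IsSeparation H A B →
               (∃ λ w → w ∈ A × w ∉ B) → (Z : Subset (n H)) → (∃ λ u → u ∈ B ─ A × u ∉ Z) →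
               ∣ Z ∣ ≤ 2 * l → order A B + ∣ Z ∩ (B ─ A) ∣ ≤ 2 * l →
               {pre : Fin (n H) → Fin k} → ProperOn H Z pre → Witness ⊎ Extension H Z pre
  glueAcross {H} rec H⊆G {A} {B} (covers , edges) (w , _ , w∉B) Z (u , u∈B─A , u∉Z)
             ∣Z∣≤2l bound pre-ok = do
    d₁ , d₁-ok , d₁≈pre ← extendOnInduced {H} rec H⊆G X (x∉p⇒∣p∣<n {p = X} u∉X) Z ∣Z∣≤2l pre-ok
    d₂ , d₂-ok , d₂≈d₁ ← extendOnInduced {H} rec H⊆G B (x∉p⇒∣p∣<n {p = B} w∉B) (X ∩ B) ∣X∩B∣≤2l
                            (ProperOn-⊆ {H = H} (p∩q⊆p X B) d₁-ok)
    let c , c-ok , c≈d₁ = glueAlongSeparation H separation d₁-ok d₂-ok d₂≈d₁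
    inj₂ (c , c-ok , λ z∈Z → trans (c≈d₁ (Z⊆X z∈Z)) (d₁≈pre z∈Z))
    where
    X : Subset (n H)
    X = A ∪ (Z ∩ B)

    u∉X : u ∉ X
    u∉X u∈X = Sum.[ proj₂ (x∈p─q⁻ B A u∈B─A) , u∉Z ∘ proj₁ ∘ x∈p∩q⁻ Z B ] (x∈p∪q⁻ A _ u∈X)

    Z⊆X : Z ⊆ X
    Z⊆X {z} z∈Z = x∈p∪q⁺ (Sum.map₂ (λ z∈B → x∈p∩q⁺ (z∈Z , z∈B)) (covers z))

    separation : IsSeparation H X B
    separation = Sum.map₁ (x∈p∪q⁺ ∘ inj₁) ∘ covers ,
                 λ x y e → Sum.map₁ (Data.Product.map (x∈p∪q⁺ ∘ inj₁) (x∈p∪q⁺ ∘ inj₁)) (edges x y e)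

    X∩B⊆ : X ∩ B ⊆ (A ∩ B) ∪ (Z ∩ (B ─ A))
    X∩B⊆ {x} x∈X∩B with x∈p∩q⁻ X B x∈X∩B | toSum (x ∈? A)
    ... | _ , x∈B | inj₁ x∈A = x∈p∪q⁺ (inj₁ (x∈p∩q⁺ (x∈A , x∈B)))
    ... | x∈X , x∈B | inj₂ x∉A = x∈p∪q⁺ (inj₂ (x∈p∩q⁺ (x∈Z , x∈p∧x∉q⇒x∈p─q x∈B x∉A)))
      where x∈Z = Sum.[ (λ x∈A → contradiction x∈A x∉A) , proj₁ ∘ x∈p∩q⁻ Z B ] (x∈p∪q⁻ A _ x∈X)

    ∣X∩B∣≤2l : ∣ X ∩ B ∣ ≤ 2 * l
    ∣X∩B∣≤2l = ≤-trans (p⊆q∪r⇒∣p∣≤∣q∣+∣r∣ {q = A ∩ B} {r = Z ∩ (B ─ A)} X∩B⊆) bound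

  splitAlong : ∀ {H} → Rec H → H ⊆G G → {A B : Subset (n H)} → TightSeparation l H A B →
               (Z : Subset (n H)) → ∣ Z ∣ ≤ 2 * l → {pre : Fin (n H) → Fin k} → ProperOn H Z pre →
               ∣ Z ∩ (B ─ A) ∣ ≤ ∣ Z ∩ (A ─ B) ∣ → Witness ⊎ Extension H Z pre
  splitAlong {H} rec H⊆G {A} {B} t Z ∣Z∣≤2l {pre} pre-ok zB≤zA = go (⊆⊎∃∉ (B ─ A) Z) (⊆⊎∃∉ (A ─ B) Z)
    where
    open TightSeparation t

    zB+zA≤2l : ∣ Z ∩ (B ─ A) ∣ + ∣ Z ∩ (A ─ B) ∣ ≤ 2 * l
    zB+zA≤2l = ≤-trans (∣p∩[q─r]∣+∣p∩[r─q]∣≤∣p∣ Z B A) ∣Z∣≤2l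

    order+zA≤2l : B ─ A ⊆ Z → order B A + ∣ Z ∩ (A ─ B) ∣ ≤ 2 * l
    order+zA≤2l B─A⊆Z = ≤-trans (+-monoˡ-≤ _ order≤zB) zB+zA≤2l
      where
      order≤zB : order B A ≤ ∣ Z ∩ (B ─ A) ∣
      order≤zB = ≤-trans (≤-reflexive (order-comm B A)) (≤-trans order≤∣B─A∣ (p⊆q⇒∣p∣≤∣q∩p∣ B─A⊆Z))

    n≤k : A ─ B ⊆ Z → B ─ A ⊆ Z → n H ≤ k
    n≤k A─B⊆Z B─A⊆Z = begin
      n H                  ≡⟨ sym (∣⊤∣≡n (n H)) ⟩
      ∣ ⊤ {n H} ∣          ≤⟨ p⊆q⇒∣p∣≤∣q∣ {p = ⊤} (λ {v} _ → ∈Z∪[A∩B] (proj₁ separation) A─B⊆Z B─A⊆Z v) ⟩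
      ∣ Z ∪ (A ∩ B) ∣      ≤⟨ ∣p∪q∣≤∣p∣+∣q∣ Z (A ∩ B) ⟩
      ∣ Z ∣ + order A B    ≤⟨ +-mono-≤ ∣Z∣≤2l order≤l ⟩
      2 * l + l            ≡⟨ +-comm (2 * l) l ⟩
      3 * l                ≤⟨ 3l≤k ⟩
      k                    ∎
      where open ≤-Reasoning

    go : B ─ A ⊆ Z ⊎ (∃ λ u → u ∈ B ─ A × u ∉ Z) → A ─ B ⊆ Z ⊎ (∃ λ u → u ∈ A ─ B × u ∉ Z) →
         Witness ⊎ Extension H Z pre
    go (inj₂ u∈B─A∖Z) _ =
      glueAcross {H} rec H⊆G separation (proj₁ proper) Z u∈B─A∖Z ∣Z∣≤2l
        (m≤l⇒n≤o⇒n+o≤2l⇒m+n≤2l order≤l zB≤zA zB+zA≤2l) pre-ok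
    go (inj₁ B─A⊆Z) (inj₂ u∈A─B∖Z) =
      glueAcross {H} rec H⊆G (IsSeparation-swap H separation) (proj₂ proper) Z u∈A─B∖Z ∣Z∣≤2l
        (order+zA≤2l B─A⊆Z) pre-ok
    go (inj₁ B─A⊆Z) (inj₁ A─B⊆Z) = inj₂ (extendInjectively H Z pre-ok (n≤k A─B⊆Z B─A⊆Z))

  step : ∀ H → Rec H → Claim H
  step H rec H⊆G Z ∣Z∣≤2l pre pre-ok with weaklyConnected⊎tightSeparation l H
  ... | inj₁ wc = weaklyConnectedCase {H} wc H⊆G Z ∣Z∣≤2l pre pre-ok
  ... | inj₂ (A , B , t) with ≤-total ∣ Z ∩ (B ─ A) ∣ ∣ Z ∩ (A ─ B) ∣
  ...   | inj₁ zB≤zA = splitAlong rec H⊆G t Z ∣Z∣≤2l pre-ok zB≤zA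
  ...   | inj₂ zA≤zB = splitAlong rec H⊆G (TightSeparation-swap H t) Z ∣Z∣≤2l pre-ok zA≤zB

  claim : ∀ H → Claim H
  claim = All.wfRec (On.wellFounded n <-wellFounded) (lsuc 0ℓ) Claim
            λ H rec → step H λ H′ → rec {H′}

lemma2p1 : (k l : ℕ) → 1 ≤ k → 1 ≤ l → 3 * l ≤ k →
    (G : Graph) → (χ> k) G →
    Σ Graph λ H → H ⊆G G × WeaklyConnected l H × (χ> (k ∸ 2 * l)) H
-- The empty precolouring still needs a total function, hence 1 ≤ k.
lemma2p1 k l 1≤k _ 3l≤k G χ>k
  with claim G 3l≤k G (id , id , λ _ _ e → e) ⊥ (≤-trans (≤-reflexive (∣⊥∣≡0 (n G))) z≤n)
         (λ _ → fromℕ< 1≤k) (λ x∈⊥ → contradiction x∈⊥ ∉⊥)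
... | inj₁ witness      = witness
... | inj₂ (c , c-ok , _) = contradiction (ProperOn⊤⇒ProperColouring G c-ok) χ>k
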